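{- For every positive integer $n$, we have $r_<(NM^<_2,K^<_n)=3n-2$.
   Context: An ordered graph on $N$ vertices is a graph with vertex set $[N]=\{1,\dots,N\}$ ordered by the usual order of integers. An ordered graph $G^<$ on $[n]$ is an ordered subgraph of an ordered graph $H^<$ on $[N]$ if there is a map $\phi:[n]\to[N]$ with $\phi(i)<\phi(j)$ whenever $i<j$ such that $\{\phi(i),\phi(j)\}$ is an edge of $H^<$ whenever $\{i,j\}$ is an edge of $G^<$. $K^<_N$ is the complete ordered graph on $[N]$. For ordered graphs $G^<,H^<$, the ordered Ramsey number $r_<(G^<,H^<)$ is the least $N$ such that every red-blue coloring of the edges of $K^<_N$ contains a red copy of $G^<$ or a blue copy of $H^<$ as an ordered subgraph. $NM^<_2$ is the ordered graph on $\{1,2,3,4\}$ with edges $\{1,4\}$ and $\{2,3\}$. -}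

module Defs where

open import Data.Nat using (ℕ; _<_)
open import Data.Fin using (Fin; toℕ) renaming (_<_ to _<ᶠ_)
open import Data.Fin.Patterns using (0F; 1F; 2F; 3F)
open import Data.Product using (Σ; _×_)
open import Relation.Binary.PropositionalEquality using (_≡_)
open import Relation.Nullary using (¬_)
open import Level using (0ℓ)

-- The edge relation is only consulted on pairs i < j; an edge {i,j} with
-- i < j is present iff  Edge i j  is inhabited.
record OrdGraph (n : ℕ) : Set₁ where
  field
    Edge : Fin n → Fin n → Set

open OrdGraph public

data Colour : Set where
  red blue : Colour

-- A red-blue colouring of the edges of K^<_N: the colour of edge {u,v}
-- with u < v is  c u v  (values on u ≥ v are irrelevant).
Colouring : ℕ → Set
Colouring N = Fin N → Fin N → Colour

MonoCopy : ∀ {n N} → OrdGraph n → Colouring N → Colour → Set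
MonoCopy {n} {N} G c col =
  Σ (Fin n → Fin N) λ φ →
    (∀ i j → i <ᶠ j → φ i <ᶠ φ j) ×
    (∀ i j → i <ᶠ j → Edge G i j → c (φ i) (φ j) ≡ col)

Arrows : ∀ {n m} → ℕ → OrdGraph n → OrdGraph m → Set
Arrows N G H = (c : Colouring N) → MonoCopy G c red Data.Sum.⊎ MonoCopy H c blue
  where import Data.Sum

IsOrdRamseyNumber : ∀ {n m} → OrdGraph n → OrdGraph m → ℕ → Set
IsOrdRamseyNumber G H R = Arrows R G H × (∀ M → M < R → ¬ Arrows M G H)

K< : (n : ℕ) → OrdGraph n
K< n = record { Edge = λ _ _ → Data.Unit.⊤ }
  where import Data.Unit

-- NM^<_2 on {1,2,3,4} (here 0F..3F) with edges {1,4} and {2,3}.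
data NM2Edge : Fin 4 → Fin 4 → Set where
  e14 : NM2Edge 0F 3F
  e23 : NM2Edge 1F 2F

NM2< : OrdGraph 4
NM2< = record { Edge = NM2Edge }

-- Lower bound: colour an edge red exactly when both ends lie in the same block
-- {3t, 3t+1, 3t+2}.  A red NM₂ would need its outer edge inside a block of three
-- vertices spanning four, and a blue clique meets each of the n blocks of [0, 3n)
-- at most once.
--
-- Upper bound: split [0, N) greedily into consecutive levels, each a blue clique,
-- opening a new level at w as soon as some edge from the current level into w is
-- red.  Between consecutive levels there is then a red edge, so a red edge u w
-- with level w ≥ level u + 3 would enclose the red edge between levels
-- level u + 1 and level u + 2, giving a red NM₂.  Hence all vertices whose levels
-- agree mod 3 span a blue clique, and one of these three classes has more than
-- n of the 3n + 1 vertices.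
module Submission where

open import Defs
open import Data.Nat using (ℕ; zero; suc; _+_; _*_; _∸_; _/_; _%_; _≤_; _<_; z≤n; s≤s; z<s; _≤?_; _<?_; _≟_)
open import Data.Nat.Properties
open import Data.Nat.DivMod using (m/n≡1+[m∸n]/n; /-monoˡ-≤; m<n*o⇒m/o<n; %-distribˡ-+; m%n<n; m<n⇒m%n≡m)
open import Data.Fin using (Fin; toℕ; fromℕ<) renaming (_<_ to _<ᶠ_; zero to fzero; suc to fsuc)
open import Data.Fin.Properties using (toℕ<n; toℕ-fromℕ<; fromℕ<-injective; pigeonhole)
open import Data.Fin.Patterns using (0F; 1F; 2F; 3F)
open import Data.Vec.Functional using ([]; _∷_)
open import Data.Product using (Σ-syntax; ∃-syntax; _×_; _,_; proj₁; proj₂)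
open import Data.Sum using (_⊎_; inj₁; inj₂)
open import Data.Bool using (if_then_else_)
open import Data.Unit using (tt)
open import Relation.Nullary using (Dec; does; yes; no; ¬_; contradiction)
open import Relation.Nullary.Decidable using (_×-dec_)
open import Relation.Unary using (Pred; Decidable)
open import Relation.Binary.PropositionalEquality

_≟ᶜ_ : (x y : Colour) → Dec (x ≡ y)
red  ≟ᶜ red  = yes refl
red  ≟ᶜ blue = no λ ()
blue ≟ᶜ red  = no λ ()
blue ≟ᶜ blue = yes refl

≢red⇒blue : ∀ {x} → x ≢ red → x ≡ blue
≢red⇒blue {red}  x≢red = contradiction refl x≢red
≢red⇒blue {blue} _     = refl

module _ {p} {A : Set p} where

  redIf : Dec A → Colour
  redIf (yes _) = red
  redIf (no  _) = blue

  redIf-red : (a? : Dec A) → redIf a? ≡ red → A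
  redIf-red (yes a) _ = a

  redIf-blue : (a? : Dec A) → redIf a? ≡ blue → ¬ A
  redIf-blue (no ¬a) _ = ¬a

blockColouring : (M : ℕ) → Colouring M
blockColouring M u v = redIf (toℕ u / 3 ≟ toℕ v / 3)

3+m≤n⇒m/3<n/3 : ∀ {m n} → 3 + m ≤ n → m / 3 < n / 3
3+m≤n⇒m/3<n/3 {m} {n} 3+m≤n = begin-strict
  m / 3           <⟨ n<1+n (m / 3) ⟩
  suc (m / 3)     ≡⟨ m/n≡1+[m∸n]/n (m≤m+n 3 m) ⟨
  (3 + m) / 3     ≤⟨ /-monoˡ-≤ 3 3+m≤n ⟩
  n / 3           ∎
  where open ≤-Reasoning

blockColouring-noRedNM₂ : ∀ M → ¬ MonoCopy NM2< (blockColouring M) red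
blockColouring-noRedNM₂ M (φ , increasing , red-edges) =
  <-irrefl (redIf-red _ (red-edges 0F 3F (s≤s z≤n) e14)) (3+m≤n⇒m/3<n/3 spans-four)
  where
  spans-four : 3 + toℕ (φ 0F) ≤ toℕ (φ 3F)
  spans-four = ≤-trans (s≤s (≤-trans (s≤s (increasing 0F 1F (s≤s z≤n))) (increasing 1F 2F (s≤s (s≤s z≤n)))))
                       (increasing 2F 3F (s≤s (s≤s (s≤s z≤n))))

blockColouring-noBlueClique : ∀ {M} n → M ≤ 3 * n → ¬ MonoCopy (K< (suc n)) (blockColouring M) blue
blockColouring-noBlueClique {M} n M≤3n (φ , _ , blue-edges) =
  let i , j , i<j , same-block = pigeonhole (n<1+n n) (λ i → fromℕ< (block<n (φ i)))
  in redIf-blue _ (blue-edges i j i<j tt) (fromℕ<-injective _ _ _ _ same-block)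
  where
  block<n : (u : Fin M) → toℕ u / 3 < n
  block<n u = m<n*o⇒m/o<n (<-≤-trans (toℕ<n u) (≤-trans M≤3n (≤-reflexive (*-comm 3 n))))

lower-bound : ∀ n M → M < suc (3 * n) → ¬ Arrows M NM2< (K< (suc n))
lower-bound n M M<3n+1 arrows with arrows (blockColouring M)
... | inj₁ red-NM₂     = blockColouring-noRedNM₂ M red-NM₂
... | inj₂ blue-clique  = blockColouring-noBlueClique n (≤-pred M<3n+1) blue-clique

module _ {p} {P : Pred ℕ p} (P? : Decidable P) where

  count : ℕ → ℕ → ℕ
  count a zero = 0
  count a (suc k) = if does (P? a) then suc (count (suc a) k) else count (suc a) k

  Enumeration : ℕ → ℕ → ℕ → Set p
  Enumeration m a k =
    Σ[ ψ ∈ (Fin m → ℕ) ] (∀ i j → i <ᶠ j → ψ i < ψ j) × (∀ i → P (ψ i) × a ≤ ψ i × ψ i < a + k)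

  Enumeration-widen : ∀ {m a k} → Enumeration m (suc a) k → Enumeration m a (suc k)
  Enumeration-widen {a = a} {k} (ψ , increasing , props) = ψ , increasing , λ i →
    let Pψ , a<ψ , ψ<a+k = props i in Pψ , <⇒≤ a<ψ , subst (ψ i <_) (sym (+-suc a k)) ψ<a+k

  Enumeration-cons : ∀ {m a k} → P a → Enumeration m (suc a) k → Enumeration (suc m) a (suc k)
  Enumeration-cons {a = a} Pa enum@(ψ , increasing , props) = (a ∷ ψ) , increasing′ , props′
    where
    increasing′ : ∀ i j → i <ᶠ j → (a ∷ ψ) i < (a ∷ ψ) j
    increasing′ fzero    (fsuc j) _         = proj₁ (proj₂ (props j))
    increasing′ (fsuc i) (fsuc j) (s≤s i<j) = increasing i j i<j
    props′ : ∀ i → P ((a ∷ ψ) i) × a ≤ (a ∷ ψ) i × (a ∷ ψ) i < a + _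
    props′ fzero    = Pa , ≤-refl , m<m+n a z<s
    props′ (fsuc i) = proj₂ (proj₂ (Enumeration-widen enum)) i

  enumerate : ∀ {m} a k → m ≤ count a k → Enumeration m a k
  enumerate a zero z≤n = (λ ()) , (λ ()) , (λ ())
  enumerate a (suc k) m≤count with P? a
  ... | no _ = Enumeration-widen (enumerate (suc a) k m≤count)
  enumerate {zero}  a (suc k) _             | yes _  = (λ ()) , (λ ()) , (λ ())
  enumerate {suc m} a (suc k) (s≤s m≤count) | yes Pa = Enumeration-cons Pa (enumerate (suc a) k m≤count)

pigeonhole₃ : ∀ {a b c} n → a + b + c ≡ suc (3 * n) → n < a ⊎ n < b ⊎ n < c
pigeonhole₃ {a} {b} {c} n sum with n <? a | n <? b | n <? c
... | yes n<a | _       | _       = inj₁ n<a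
... | _       | yes n<b | _       = inj₂ (inj₁ n<b)
... | _       | _       | yes n<c = inj₂ (inj₂ n<c)
... | no n≮a  | no n≮b  | no n≮c  = contradiction sum (<⇒≢ (s≤s (begin
  a + b + c      ≤⟨ +-mono-≤ (+-mono-≤ (≮⇒≥ n≮a) (≮⇒≥ n≮b)) (≮⇒≥ n≮c) ⟩
  n + n + n      ≡⟨ +-assoc n n n ⟩
  n + (n + n)    ≡⟨ cong (λ t → n + (n + t)) (+-identityʳ n) ⟨
  3 * n          ∎)))
  where open ≤-Reasoning

inClass? : (cls : ℕ → ℕ) (r : ℕ) → Decidable (λ v → cls v ≡ r)
inClass? cls r v = cls v ≟ r

module _ (cls : ℕ → ℕ) (cls<3 : ∀ v → cls v < 3) where

  count-classes : ∀ a k → count (inClass? cls 0) a k + count (inClass? cls 1) a k + count (inClass? cls 2) a k ≡ k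
  count-classes a zero = refl
  count-classes a (suc k)
    with count (inClass? cls 0) (suc a) k | count (inClass? cls 1) (suc a) k
       | count (inClass? cls 2) (suc a) k | count-classes (suc a) k | cls a | cls<3 a
  ... | c₀ | c₁ | c₂ | sum | 0 | _ = cong suc sum
  ... | c₀ | c₁ | c₂ | sum | 1 | _ = trans (cong (_+ c₂) (+-suc c₀ c₁)) (cong suc sum)
  ... | c₀ | c₁ | c₂ | sum | 2 | _ = trans (+-suc (c₀ + c₁) c₂) (cong suc sum)
  ... | _  | _  | _  | _   | suc (suc (suc _)) | s≤s (s≤s (s≤s ()))

  large-class : ∀ n → ∃[ r ] n < count (inClass? cls r) 0 (suc (3 * n))
  large-class n with pigeonhole₃ n (count-classes 0 (suc (3 * n)))
  ... | inj₁ large        = 0 , large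
  ... | inj₂ (inj₁ large) = 1 , large
  ... | inj₂ (inj₂ large) = 2 , large

residue-shift : ∀ m d → 0 < d → d < 3 → (m + d) % 3 ≢ m % 3
residue-shift m d 0<d d<3 eq = shift (m % 3) 0<d d<3 (m%n<n m 3) (begin
  (m % 3 + d) % 3       ≡⟨ cong (λ e → (m % 3 + e) % 3) (m<n⇒m%n≡m d<3) ⟨
  (m % 3 + d % 3) % 3   ≡⟨ %-distribˡ-+ m d 3 ⟨
  (m + d) % 3           ≡⟨ eq ⟩
  m % 3                 ∎)
  where
  open ≡-Reasoning
  shift : ∀ x {d} → 0 < d → d < 3 → x < 3 → (x + d) % 3 ≢ x
  shift _ {suc (suc (suc _))} _ (s≤s (s≤s (s≤s ())))
  shift (suc (suc (suc _))) _ _ (s≤s (s≤s (s≤s ())))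
  shift 0 {1} _ _ _ ()
  shift 0 {2} _ _ _ ()
  shift 1 {1} _ _ _ ()
  shift 1 {2} _ _ _ ()
  shift 2 {1} _ _ _ ()
  shift 2 {2} _ _ _ ()

same-residue : ∀ {m n} → m ≤ n → m % 3 ≡ n % 3 → m ≡ n ⊎ 3 + m ≤ n
same-residue {m} m≤n m≡n with m≤n⇒∃[o]m+o≡n m≤n
... | 0 , refl = inj₁ (sym (+-identityʳ m))
... | 1 , refl = contradiction (sym m≡n) (residue-shift m 1 z<s (s≤s (s≤s z≤n)))
... | 2 , refl = contradiction (sym m≡n) (residue-shift m 2 z<s (s≤s (s≤s (s≤s z≤n))))
... | suc (suc (suc d)) , refl = inj₂ (≤-trans (≤-reflexive (+-comm 3 m)) (+-monoʳ-≤ m (m≤m+n 3 d)))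

-- Quantified from the right end so that anyUpTo? decides it.
RedNM₂ : (ℕ → ℕ → Colour) → ℕ → Set
RedNM₂ col N = ∃[ d ] d < N × ∃[ x ] x < d × ∃[ b ] b < x × ∃[ a ] a < b × col a d ≡ red × col b x ≡ red

redNM₂? : ∀ col N → Dec (RedNM₂ col N)
redNM₂? col = anyUpTo? λ d → anyUpTo? (λ x → anyUpTo? (λ b → anyUpTo? (λ a →
  (col a d ≟ᶜ red) ×-dec (col b x ≟ᶜ red)) b) x) d

CopyBelow : ∀ {n} → ℕ → OrdGraph n → (ℕ → ℕ → Colour) → Colour → Set
CopyBelow {n} N G col k =
  Σ[ ψ ∈ (Fin n → ℕ) ] (∀ i → ψ i < N) × (∀ i j → i <ᶠ j → ψ i < ψ j) ×
                       (∀ i j → i <ᶠ j → Edge G i j → col (ψ i) (ψ j) ≡ k)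

redNM₂⇒copy : ∀ {col N} → RedNM₂ col N → CopyBelow N NM2< col red
redNM₂⇒copy {col} {N} (d , d<N , x , x<d , b , b<x , a , a<b , ad-red , bx-red) =
  ψ , below , increasing , edges
  where
  ψ : Fin 4 → ℕ
  ψ = a ∷ b ∷ x ∷ d ∷ []
  x<N : x < N
  x<N = <-trans x<d d<N
  b<N : b < N
  b<N = <-trans b<x x<N
  below : ∀ i → ψ i < N
  below 0F = <-trans a<b b<N
  below 1F = b<N
  below 2F = x<N
  below 3F = d<N
  increasing : ∀ i j → i <ᶠ j → ψ i < ψ j
  increasing _  0F ()
  increasing 0F 1F _ = a<b
  increasing (fsuc _) 1F (s≤s ())
  increasing 0F 2F _ = <-trans a<b b<x
  increasing 1F 2F _ = b<x
  increasing (fsuc (fsuc _)) 2F (s≤s (s≤s ()))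
  increasing 0F 3F _ = <-trans a<b (<-trans b<x x<d)
  increasing 1F 3F _ = <-trans b<x x<d
  increasing 2F 3F _ = x<d
  increasing 3F 3F (s≤s (s≤s (s≤s ())))
  edges : ∀ i j → i <ᶠ j → NM2Edge i j → col (ψ i) (ψ j) ≡ red
  edges _ _ _ e14 = ad-red
  edges _ _ _ e23 = bx-red

module Levels (col : ℕ → ℕ → Colour) where

  RedInto : ℕ → ℕ → Set
  RedInto s w = ∃[ u ] u < w × s ≤ u × col u w ≡ red

  redInto? : ∀ s w → Dec (RedInto s w)
  redInto? s w = anyUpTo? (λ u → (s ≤? u) ×-dec (col u w ≟ᶜ red)) w

  -- The state is (level of v, first vertex of that level).
  next : ℕ → ℕ × ℕ → ℕ × ℕ
  next v (k , s) with redInto? s (suc v)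
  ... | yes _ = suc k , suc v
  ... | no  _ = k , s

  layer : ℕ → ℕ × ℕ
  layer zero    = 0 , 0
  layer (suc v) = next v (layer v)

  level start : ℕ → ℕ
  level v = proj₁ (layer v)
  start v = proj₂ (layer v)

  levelClass : ℕ → ℕ
  levelClass v = level v % 3

  level-opens : ∀ {v} → RedInto (start v) (suc v) → level (suc v) ≡ suc (level v)
  level-opens {v} red-into with redInto? (start v) (suc v)
  ... | yes _   = refl
  ... | no ¬red = contradiction red-into ¬red

  level-suc : ∀ v → level v ≤ level (suc v)
  level-suc v with redInto? (start v) (suc v)
  ... | yes _ = n≤1+n _
  ... | no  _ = ≤-refl

  level-mono-≤ : ∀ {u v} → u ≤ v → level u ≤ level v
  level-mono-≤ {v = zero} z≤n = ≤-refl
  level-mono-≤ {u} {suc v} u≤1+v with m≤n⇒m<n∨m≡n u≤1+v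
  ... | inj₁ (s≤s u≤v) = ≤-trans (level-mono-≤ u≤v) (level-suc v)
  ... | inj₂ refl      = ≤-refl

  level-cancel-< : ∀ {u v} → level u < level v → u < v
  level-cancel-< {u} {v} lu<lv with u <? v
  ... | yes u<v = u<v
  ... | no  u≮v = contradiction (level-mono-≤ (≮⇒≥ u≮v)) (<⇒≱ lu<lv)

  below-new-level : ∀ {u v} → u ≤ v → level u ≢ suc (level v)
  below-new-level u≤v = <⇒≢ (s≤s (level-mono-≤ u≤v))

  start-≤ : ∀ v → start v ≤ v
  start-≤ zero = z≤n
  start-≤ (suc v) with redInto? (start v) (suc v)
  ... | yes _ = ≤-refl
  ... | no  _ = m≤n⇒m≤1+n (start-≤ v)

  level-start : ∀ v → level (start v) ≡ level v
  level-start zero = refl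
  level-start (suc v) with redInto? (start v) (suc v)
  ... | yes red-into = level-opens red-into
  ... | no  _ = level-start v

  start-least : ∀ {u v} → u ≤ v → level u ≡ level v → start v ≤ u
  start-least {v = zero} z≤n _ = z≤n
  start-least {u} {suc v} u≤1+v lu≡lv with m≤n⇒m<n∨m≡n u≤1+v
  ... | inj₂ refl = start-≤ u
  ... | inj₁ (s≤s u≤v) with redInto? (start v) (suc v)
  ...   | yes _ = contradiction lu≡lv (below-new-level u≤v)
  ...   | no  _ = start-least u≤v lu≡lv

  same-level-blue : ∀ {u w} → u < w → level u ≡ level w → col u w ≡ blue
  same-level-blue {u} {suc v} (s≤s u≤v) lu≡lw with redInto? (start v) (suc v)
  ... | yes _    = contradiction lu≡lw (below-new-level u≤v)
  ... | no ¬red = ≢red⇒blue λ uw-red → ¬red (u , s≤s u≤v , start-least u≤v lu≡lw , uw-red)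

  RedCrossing : ℕ → ℕ → Set
  RedCrossing k w = ∃[ a ] ∃[ b ] level a ≡ k × level b ≡ suc k × b ≤ w × col a b ≡ red

  RedCrossing-suc : ∀ {k w} → RedCrossing k w → RedCrossing k (suc w)
  RedCrossing-suc (a , b , la , lb , b≤w , red-edge) = a , b , la , lb , m≤n⇒m≤1+n b≤w , red-edge

  red-crossing : ∀ w k → k < level w → RedCrossing k w
  red-crossing zero k ()
  red-crossing (suc v) k k<lw with redInto? (start v) (suc v)
  ... | no _ = RedCrossing-suc (red-crossing v k k<lw)
  ... | yes red-into@(u , s≤s u≤v , s≤u , red-edge) with m≤n⇒m<n∨m≡n (≤-pred k<lw)
  ...   | inj₁ k<lv = RedCrossing-suc (red-crossing v k k<lv)
  ...   | inj₂ refl = u , suc v , level-of-u , level-opens red-into , ≤-refl , red-edge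
    where
    level-of-u : level u ≡ level v
    level-of-u = ≤-antisym (level-mono-≤ u≤v) (subst (_≤ level u) (level-start v) (level-mono-≤ s≤u))

  module _ {N} (nm-free : ¬ RedNM₂ col N) where

    distant-levels-blue : ∀ {u w} → w < N → 3 + level u ≤ level w → col u w ≡ blue
    distant-levels-blue {u} {w} w<N 3+lu≤lw = ≢red⇒blue λ uw-red →
      let a , b , la , lb , _ , ab-red = red-crossing w (suc (level u)) (≤-trans (n≤1+n _) 3+lu≤lw)
          u<a = level-cancel-< (≤-reflexive (sym la))
          a<b = level-cancel-< (≤-reflexive (trans (cong suc la) (sym lb)))
          b<w = level-cancel-< (subst (λ l → suc l ≤ level w) (sym lb) 3+lu≤lw)
      in nm-free (w , w<N , b , b<w , a , a<b , u , u<a , uw-red , ab-red)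

    same-class-blue : ∀ {u w} → u < w → w < N → levelClass u ≡ levelClass w → col u w ≡ blue
    same-class-blue u<w w<N same-class with same-residue (level-mono-≤ (<⇒≤ u<w)) same-class
    ... | inj₁ same-level = same-level-blue u<w same-level
    ... | inj₂ distant    = distant-levels-blue w<N distant

  blue-clique : ∀ n → ¬ RedNM₂ col (suc (3 * n)) → CopyBelow (suc (3 * n)) (K< (suc n)) col blue
  blue-clique n nm-free with large-class levelClass (λ v → m%n<n (level v) 3) n
  ... | r , large with enumerate (inClass? levelClass r) 0 (suc (3 * n)) large
  ... | ψ , increasing , props = ψ , below , increasing , λ i j i<j _ →
    same-class-blue nm-free (increasing i j i<j) (below j) (trans (proj₁ (props i)) (sym (proj₁ (props j))))
    where
    below : ∀ i → ψ i < suc (3 * n)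
    below i = proj₂ (proj₂ (props i))

module _ {N} (c : Colouring N) where

  -- The colour outside [0, N) is never looked at.
  extend : ℕ → ℕ → Colour
  extend u w with u <? N | w <? N
  ... | yes u<N | yes w<N = c (fromℕ< u<N) (fromℕ< w<N)
  ... | _       | _       = blue

  extend-fromℕ< : ∀ {u w} (u<N : u < N) (w<N : w < N) → extend u w ≡ c (fromℕ< u<N) (fromℕ< w<N)
  extend-fromℕ< {u} {w} u<N w<N with u <? N | w <? N
  ... | yes _  | yes _  = refl
  ... | no u≮N | _      = contradiction u<N u≮N
  ... | yes _  | no w≮N = contradiction w<N w≮N

  copyBelow⇒monoCopy : ∀ {n} {G : OrdGraph n} {k} → CopyBelow N G extend k → MonoCopy G c k
  copyBelow⇒monoCopy (ψ , below , increasing , edges) =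
    (λ i → fromℕ< (below i)) ,
    (λ i j i<j → subst₂ _<_ (sym (toℕ-fromℕ< (below i))) (sym (toℕ-fromℕ< (below j))) (increasing i j i<j)) ,
    (λ i j i<j e → trans (sym (extend-fromℕ< (below i) (below j))) (edges i j i<j e))

upper-bound : ∀ n → Arrows (suc (3 * n)) NM2< (K< (suc n))
upper-bound n c with redNM₂? (extend c) (suc (3 * n))
... | yes red-NM₂ = inj₁ (copyBelow⇒monoCopy c (redNM₂⇒copy red-NM₂))
... | no nm-free  = inj₂ (copyBelow⇒monoCopy c (Levels.blue-clique (extend c) n nm-free))

theorem9 : (n : ℕ) → IsOrdRamseyNumber NM2< (K< (suc n)) (3 * suc n ∸ 2)
theorem9 n = subst (IsOrdRamseyNumber NM2< (K< (suc n))) 3n+1≡3[n+1]∸2 (upper-bound n , lower-bound n)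
  where
  3n+1≡3[n+1]∸2 : suc (3 * n) ≡ 3 * suc n ∸ 2
  3n+1≡3[n+1]∸2 = cong (_∸ 2) (sym (*-suc 3 n))
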